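{- Asymptotically almost no lambda term is strongly normalizing: the density, among all lambda terms, of the strongly normalizing terms is $0$.
   Context: Lambda terms in de Bruijn notation: $M ::= \underline{0} \mid S\,n \mid \lambda M \mid M\,M$ with de Bruijn indices $n ::= \underline{0}\mid S\,n$ (not necessarily closed). Size: $|\underline{0}|=1$, $|S\,n|=|n|+1$, $|\lambda M|=|M|+1$, $|M_1M_2|=|M_1|+|M_2|+1$. A term is strongly normalizing if every sequence of $\beta$-reduction steps starting from it is finite. The density of a set $\mathcal{A}$ of terms among all terms is $\lim_{n\to\infty}A_n/L_n$, with $A_n$ the number of elements of $\mathcal{A}$ of size $n$ and $L_n$ the number of all terms of size $n$. -}

module Defs where

open import Data.Nat using (ℕ; zero; suc; _+_; _*_; _≤_; _<_)
open import Data.Nat.Properties using (<-cmp)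
open import Data.List using (List; length)
open import Data.List.Relation.Unary.All using (All)
open import Data.List.Relation.Unary.Unique.Propositional using (Unique)
open import Data.List.Membership.Propositional using (_∈_)
open import Relation.Binary.Definitions using (tri<; tri≈; tri>)
open import Relation.Binary.PropositionalEquality using (_≡_)
open import Induction.WellFounded using (Acc)

-- Lambda terms in de Bruijn notation (not necessarily closed).
-- The de Bruijn index  S^k 0  is represented by  var k.
data Term : Set where
  var : ℕ → Term
  lam : Term → Term
  app : Term → Term → Term

-- Size as in the paper: |0| = 1, |S n| = |n| + 1, so |var k| = k + 1;
-- |λ M| = |M| + 1, |M N| = |M| + |N| + 1.
size : Term → ℕ
size (var k)   = suc k
size (lam M)   = suc (size M)
size (app M N) = suc (size M + size N)

shift : ℕ → Term → Term
shift c (var k) with <-cmp k c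
... | tri< _ _ _ = var k
... | tri≈ _ _ _ = var (suc k)
... | tri> _ _ _ = var (suc k)
shift c (lam M)   = lam (shift (suc c) M)
shift c (app M N) = app (shift c M) (shift c N)

shiftBy : ℕ → Term → Term
shiftBy zero    N = N
shiftBy (suc j) N = shift 0 (shiftBy j N)

-- sub j N M : substitute N for index j in M (under j binders),
-- decrementing the free indices above j (the binder is removed).
sub : ℕ → Term → Term → Term
sub j N (var k) with <-cmp k j
... | tri< _ _ _ = var k
... | tri≈ _ _ _ = shiftBy j N
sub j N (var (suc k)) | tri> _ _ _ = var k
sub j N (var zero)    | tri> _ _ _ = var zero   -- impossible case (0 > j)
sub j N (lam M)   = lam (sub (suc j) N M)
sub j N (app M P) = app (sub j N M) (sub j N P)

infix 4 _⟶_
data _⟶_ : Term → Term → Set where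
  β    : ∀ {M N} → app (lam M) N ⟶ sub 0 N M
  ξlam : ∀ {M M'} → M ⟶ M' → lam M ⟶ lam M'
  ξl   : ∀ {M M' N} → M ⟶ M' → app M N ⟶ app M' N
  ξr   : ∀ {M N N'} → N ⟶ N' → app M N ⟶ app M N'

SN : Term → Set
SN = Acc (λ N M → M ⟶ N)

-- A strongly normalising term has no subterm Ω = (λx.xx)(λx.xx), since SN is inherited
-- by subterms and Ω ⟶ Ω. Let L n count the terms of size n and G n the Ω-free ones.
-- Splitting on the head constructor gives L (m+1) = 1 + L m + Σᵢ L i · L (m−i); G obeys
-- the same recurrence as an inequality, and G 9 < L 9 because |Ω| = 9. If G ≤ (E/D)^t L
-- holds eventually, feeding it into the recurrence gains from the summand i = 9 a deficit
-- of order L (m−9), which is at least L (m+1) / 6^10 by the ratio bound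
-- L (m+2) ≤ 6 L (m+1); this gives G ≤ (E/D)^(t+1) L eventually, for E = 6^10 + 1 and
-- D = E + 1. As (D/E)^t is unbounded, G n / L n → 0. The ratio bound comes from the
-- weighted identity (m+2) Σᵢ L i L (m−i) = 2 Σᵢ (i+1) L i L (m−i), a discrete analogue of
-- differentiating the generating-function equation.

module Submission where

open import Defs
open import Data.Nat using (ℕ; zero; suc; _+_; _*_; _∸_; _^_; _≤_; _<_; z≤n; s≤s; _≤?_)
  renaming (_≟_ to _≟ℕ_)
open import Data.Nat.Properties hiding (_≟_)
open import Data.Nat.Tactic.RingSolver using (solve-∀)
import Algebra.Properties.CommutativeSemigroup +-commutativeSemigroup as +
import Algebra.Properties.CommutativeSemigroup *-commutativeSemigroup as *
open import Data.Product using (∃-syntax; ∃₂; _×_; _,_; proj₁; proj₂; uncurry)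
open import Data.Sum using (inj₁; inj₂)
open import Data.List using (List; []; _∷_; length; map; _++_; filter; cartesianProductWith)
open import Data.List.Properties using (length-++; length-map; length-filter; filter-++; filter-none; filter-notAll)
open import Data.List.Membership.Propositional using (_∈_; lose)
open import Data.List.Membership.Propositional.Properties
  using (∈-map⁺; ∈-map⁻; ∈-++⁺ˡ; ∈-++⁺ʳ; ∈-++⁻; ∈-cartesianProductWith⁺; ∈-cartesianProductWith⁻; ∈-∃++; ∈-filter⁺)
open import Data.List.Relation.Binary.Subset.Propositional using (_⊆_)
open import Data.List.Relation.Unary.Any using (here; there)
open import Data.List.Relation.Unary.All as All using (All)
import Data.List.Relation.Unary.All.Properties as All
open import Data.List.Relation.Unary.AllPairs using ([]; _∷_)
open import Data.List.Relation.Unary.Unique.Propositional using (Unique)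
import Data.List.Relation.Unary.Unique.Propositional.Properties as Unique
open import Function using (_∘_)
open import Induction.WellFounded using (acc)
open import Relation.Binary.Definitions using (DecidableEquality)
open import Relation.Binary.PropositionalEquality
open import Relation.Nullary using (¬_; yes; no; contradiction; ¬?; _×-dec_)
open import Relation.Nullary.Decidable using (map′)
open import Relation.Unary using (Decidable)

sumTo : (ℕ → ℕ) → ℕ → ℕ
sumTo h zero    = h 0
sumTo h (suc m) = sumTo h m + h (suc m)

conv : (ℕ → ℕ) → (ℕ → ℕ) → ℕ → ℕ
conv f g m = sumTo (λ i → f i * g (m ∸ i)) m

sumTo-suc : ∀ h m → sumTo h (suc m) ≡ h 0 + sumTo (h ∘ suc) m
sumTo-suc h zero    = refl
sumTo-suc h (suc m) = trans (cong (_+ h (2 + m)) (sumTo-suc h m)) (+-assoc (h 0) _ _)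

sumTo-cong : ∀ {h h′} m → (∀ i → i ≤ m → h i ≡ h′ i) → sumTo h m ≡ sumTo h′ m
sumTo-cong zero    h≡h′ = h≡h′ 0 z≤n
sumTo-cong (suc m) h≡h′ =
  cong₂ _+_ (sumTo-cong m (λ i i≤m → h≡h′ i (m≤n⇒m≤1+n i≤m))) (h≡h′ (suc m) ≤-refl)

sumTo-mono-≤ : ∀ {h h′} m → (∀ i → i ≤ m → h i ≤ h′ i) → sumTo h m ≤ sumTo h′ m
sumTo-mono-≤ zero    h≤h′ = h≤h′ 0 z≤n
sumTo-mono-≤ (suc m) h≤h′ =
  +-mono-≤ (sumTo-mono-≤ m (λ i i≤m → h≤h′ i (m≤n⇒m≤1+n i≤m))) (h≤h′ (suc m) ≤-refl)

sumTo-mono-≤-gap : ∀ {h h′ j δ} m → j ≤ m → (∀ i → i ≤ m → h i ≤ h′ i) →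
                   h j + δ ≤ h′ j → sumTo h m + δ ≤ sumTo h′ m
sumTo-mono-≤-gap zero    z≤n  _    gap = gap
sumTo-mono-≤-gap {h} {h′} {j} {δ} (suc m) j≤1+m h≤h′ gap with m≤n⇒m<n∨m≡n j≤1+m
... | inj₂ refl = begin
  sumTo h m + h j + δ     ≡⟨ +-assoc (sumTo h m) (h j) δ ⟩
  sumTo h m + (h j + δ)   ≤⟨ +-mono-≤ (sumTo-mono-≤ m (λ i i≤m → h≤h′ i (m≤n⇒m≤1+n i≤m))) gap ⟩
  sumTo h′ m + h′ j       ∎
  where open ≤-Reasoning
... | inj₁ j<1+m = begin
  sumTo h m + h (suc m) + δ ≡⟨ +.xy∙z≈xz∙y (sumTo h m) (h (suc m)) δ ⟩
  sumTo h m + δ + h (suc m) ≤⟨ +-mono-≤ (sumTo-mono-≤-gap m (≤-pred j<1+m) (λ i i≤m → h≤h′ i (m≤n⇒m≤1+n i≤m)) gap)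
                                         (h≤h′ (suc m) ≤-refl) ⟩
  sumTo h′ m + h′ (suc m)   ∎
  where open ≤-Reasoning

sumTo-+ : ∀ h h′ m → sumTo (λ i → h i + h′ i) m ≡ sumTo h m + sumTo h′ m
sumTo-+ h h′ zero    = refl
sumTo-+ h h′ (suc m) =
  trans (cong (_+ (h (suc m) + h′ (suc m))) (sumTo-+ h h′ m))
        (+.interchange (sumTo h m) (sumTo h′ m) (h (suc m)) (h′ (suc m)))

sumTo-*ˡ : ∀ c h m → sumTo (λ i → c * h i) m ≡ c * sumTo h m
sumTo-*ˡ c h zero    = refl
sumTo-*ˡ c h (suc m) = trans (cong (_+ c * h (suc m)) (sumTo-*ˡ c h m)) (sym (*-distribˡ-+ c _ _))

sumTo-reverse : ∀ h m → sumTo h m ≡ sumTo (λ i → h (m ∸ i)) m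
sumTo-reverse h zero    = refl
sumTo-reverse h (suc m) = begin
  sumTo h m + h (suc m)                          ≡⟨ cong (_+ h (suc m)) (sumTo-reverse h m) ⟩
  sumTo (λ i → h (m ∸ i)) m + h (suc m)          ≡⟨ +-comm _ (h (suc m)) ⟩
  h (suc m) + sumTo (λ i → h (m ∸ i)) m          ≡⟨ sym (sumTo-suc (λ i → h (suc m ∸ i)) m) ⟩
  sumTo (λ i → h (suc m ∸ i)) (suc m)            ∎
  where open ≡-Reasoning

conv-comm : ∀ f g m → conv f g m ≡ conv g f m
conv-comm f g m = trans (sumTo-reverse _ m) (sumTo-cong m swap)
  where
  swap : ∀ i → i ≤ m → f (m ∸ i) * g (m ∸ (m ∸ i)) ≡ g i * f (m ∸ i)
  swap i i≤m = trans (*-comm (f (m ∸ i)) _) (cong (λ j → g j * f (m ∸ i)) (m∸[m∸n]≡n i≤m))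

conv-suc : ∀ f g m → conv f g (suc m) ≡ f 0 * g (suc m) + conv (f ∘ suc) g m
conv-suc f g m = sumTo-suc (λ i → f i * g (suc m ∸ i)) m

-- Discrete product rule: in the i-th term the weight splits as (p + i) + (q + (m ∸ i)).
conv-weight : ∀ p q f g m →
  (p + q + m) * conv f g m ≡ conv (λ i → (p + i) * f i) g m + conv f (λ j → (q + j) * g j) m
conv-weight p q f g m =
  trans (sym (sumTo-*ˡ (p + q + m) _ m)) (trans (sumTo-cong m split) (sumTo-+ _ _ m))
  where
  ring : ∀ p q i j a b → (p + q + (i + j)) * (a * b) ≡ (p + i) * a * b + a * ((q + j) * b)
  ring = solve-∀
  split : ∀ i → i ≤ m → (p + q + m) * (f i * g (m ∸ i)) ≡
                        (p + i) * f i * g (m ∸ i) + f i * ((q + (m ∸ i)) * g (m ∸ i))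
  split i i≤m = trans (cong (λ n → (p + q + n) * (f i * g (m ∸ i))) (sym (m+[n∸m]≡n i≤m)))
                      (ring p q i (m ∸ i) (f i) (g (m ∸ i)))

conv-weight-sym : ∀ p f m → (p + p + m) * conv f f m ≡ 2 * conv (λ i → (p + i) * f i) f m
conv-weight-sym p f m = begin
  (p + p + m) * conv f f m ≡⟨ conv-weight p p f f m ⟩
  S + conv f (λ j → (p + j) * f j) m ≡⟨ cong (S +_) (conv-comm f (λ j → (p + j) * f j) m) ⟩
  S + S                              ≡⟨ cong (S +_) (sym (+-identityʳ S)) ⟩
  2 * S                              ∎
  where
  open ≡-Reasoning
  S = conv (λ i → (p + i) * f i) f m

module RatioBound (L : ℕ → ℕ) (L-zero : L 0 ≡ 0)
                     (L-suc : ∀ m → L (suc m) ≡ 1 + L m + conv L L m) where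

  L-one : L 1 ≡ 1
  L-one = trans (L-suc 0) (cong (λ x → 1 + x + x * x) L-zero)

  slack : ℕ → ℕ
  slack zero    = 2
  slack (suc _) = 0

  slack≤2 : ∀ a → slack a ≤ 2
  slack≤2 zero    = ≤-refl
  slack≤2 (suc _) = z≤n

  sumTo-slack : ∀ (h : ℕ → ℕ) m → sumTo (λ a → slack a * h a) m ≡ 2 * h 0
  sumTo-slack h zero    = refl
  sumTo-slack h (suc m) = trans (+-identityʳ (sumTo (λ a → slack a * h a) m)) (sumTo-slack h m)

  -- suc i * L i ≤ bound i says (a + 2) L (a + 1) ≤ 6 a L a for a ≥ 1; the slack covers
  -- a = 0, where 2 L 1 = 2.
  bound : ℕ → ℕ
  bound zero    = 0
  bound (suc a) = slack a + 6 * (a * L a)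

  weighted-conv-bound : ∀ m → (∀ i → i ≤ suc m → suc i * L i ≤ bound i) →
                        conv (λ i → suc i * L i) L (suc m) ≤ 2 * L m + 6 * conv (λ i → i * L i) L m
  weighted-conv-bound m IH = begin
    conv (λ i → suc i * L i) L (suc m)
      ≤⟨ sumTo-mono-≤ (suc m) (λ i i≤ → *-monoˡ-≤ (L (suc m ∸ i)) (IH i i≤)) ⟩
    sumTo (λ i → bound i * L (suc m ∸ i)) (suc m)
      ≡⟨ sumTo-suc (λ i → bound i * L (suc m ∸ i)) m ⟩
    sumTo (λ a → (slack a + 6 * (a * L a)) * L (m ∸ a)) m
      ≡⟨ sumTo-cong m (λ a _ → distrib (slack a) (a * L a) (L (m ∸ a))) ⟩
    sumTo (λ a → slack a * L (m ∸ a) + 6 * (a * L a * L (m ∸ a))) m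
      ≡⟨ sumTo-+ _ _ m ⟩
    sumTo (λ a → slack a * L (m ∸ a)) m + sumTo (λ a → 6 * (a * L a * L (m ∸ a))) m
      ≡⟨ cong₂ _+_ (sumTo-slack (λ a → L (m ∸ a)) m) (sumTo-*ˡ 6 (λ a → a * L a * L (m ∸ a)) m) ⟩
    2 * L m + 6 * conv (λ i → i * L i) L m ∎
    where
    open ≤-Reasoning
    distrib : ∀ s x y → (s + 6 * x) * y ≡ s * y + 6 * (x * y)
    distrib = solve-∀

  weighted-bound-suc : ∀ m → (∀ i → i ≤ m → suc i * L i ≤ bound i) →
                       suc (suc m) * L (suc m) ≤ bound (suc m)
  weighted-bound-suc zero    _  = ≤-reflexive (cong (2 *_) L-one)
  weighted-bound-suc (suc m) IH = begin
    (3 + m) * L (2 + m)                                 ≡⟨ cong ((3 + m) *_) (L-suc (suc m)) ⟩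
    (3 + m) * (1 + a + c₁)                              ≡⟨ distrib m a c₁ ⟩
    (3 + m) + (a + (2 + m) * a) + (3 + m) * c₁
      ≤⟨ +-mono-≤ (+-monoʳ-≤ (3 + m) (+-monoʳ-≤ a a-bound)) (≤-reflexive (conv-weight-sym 1 L (suc m))) ⟩
    (3 + m) + (a + (2 + 6 * (m * Lm))) + 2 * S₁
      ≤⟨ +-monoʳ-≤ ((3 + m) + (a + (2 + 6 * (m * Lm)))) (*-monoʳ-≤ 2 (weighted-conv-bound m IH)) ⟩
    (3 + m) + (a + (2 + 6 * (m * Lm))) + 2 * (2 * Lm + 6 * W)
      ≡⟨ cong ((3 + m) + (a + (2 + 6 * (m * Lm))) +_) doubled ⟩
    (3 + m) + (a + (2 + 6 * (m * Lm))) + (4 * Lm + 6 * (m * c₀))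
      ≡⟨ cong (λ x → (3 + m) + (x + (2 + 6 * (m * Lm))) + (4 * Lm + 6 * (m * c₀))) (L-suc m) ⟩
    (3 + m) + ((1 + Lm + c₀) + (2 + 6 * (m * Lm))) + (4 * Lm + 6 * (m * c₀))
      ≤⟨ m≤m+n _ (Lm + 5 * c₀ + 5 * m) ⟩
    (3 + m) + ((1 + Lm + c₀) + (2 + 6 * (m * Lm))) + (4 * Lm + 6 * (m * c₀)) + (Lm + 5 * c₀ + 5 * m)
      ≡⟨ collect m Lm c₀ ⟩
    6 * (suc m * (1 + Lm + c₀))                         ≡⟨ cong (λ x → 6 * (suc m * x)) (sym (L-suc m)) ⟩
    6 * (suc m * a)                                     ∎
    where
    open ≤-Reasoning
    a  = L (suc m)
    Lm = L m
    c₀ = conv L L m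
    c₁ = conv L L (suc m)
    S₁ = conv (λ i → suc i * L i) L (suc m)
    W  = conv (λ i → i * L i) L m
    a-bound : (2 + m) * a ≤ 2 + 6 * (m * Lm)
    a-bound = ≤-trans (IH (suc m) ≤-refl) (+-monoˡ-≤ (6 * (m * Lm)) (slack≤2 m))
    doubled : 2 * (2 * Lm + 6 * W) ≡ 4 * Lm + 6 * (m * c₀)
    doubled = trans (regroup Lm W) (cong (λ x → 4 * Lm + 6 * x) (sym (conv-weight-sym 0 L m)))
      where
      regroup : ∀ l w → 2 * (2 * l + 6 * w) ≡ 4 * l + 6 * (2 * w)
      regroup = solve-∀
    distrib : ∀ m a c → (3 + m) * (1 + a + c) ≡ (3 + m) + (a + (2 + m) * a) + (3 + m) * c
    distrib = solve-∀
    collect : ∀ m l c → (3 + m) + ((1 + l + c) + (2 + 6 * (m * l))) + (4 * l + 6 * (m * c)) + (l + 5 * c + 5 * m)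
                        ≡ 6 * (suc m * (1 + l + c))
    collect = solve-∀

  weighted-bound : ∀ m i → i ≤ m → suc i * L i ≤ bound i
  weighted-bound zero    zero    _ = ≤-reflexive (cong (_+ 0) L-zero)
  weighted-bound (suc m) i i≤1+m with m≤n⇒m<n∨m≡n i≤1+m
  ... | inj₁ i≤m = weighted-bound m i (≤-pred i≤m)
  ... | inj₂ refl = weighted-bound-suc m (weighted-bound m)

  L-ratio : ∀ m → L (2 + m) ≤ 6 * L (suc m)
  L-ratio m = *-cancelˡ-≤ (suc m) (begin
    suc m * L (2 + m)         ≤⟨ *-monoˡ-≤ (L (2 + m)) (n≤1+n (suc m)) ⟩
    (2 + m) * L (2 + m)       ≤⟨ m≤n+m _ (L (2 + m)) ⟩
    suc (2 + m) * L (2 + m)   ≤⟨ weighted-bound (2 + m) (2 + m) ≤-refl ⟩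
    6 * (suc m * L (suc m))   ≡⟨ *.x∙yz≈y∙xz 6 (suc m) (L (suc m)) ⟩
    suc m * (6 * L (suc m))   ∎)
    where open ≤-Reasoning

  L-ratio-iterate : ∀ j m → L (j + suc m) ≤ 6 ^ j * L (suc m)
  L-ratio-iterate zero    m = ≤-reflexive (sym (+-identityʳ _))
  L-ratio-iterate (suc j) m = begin
    L (suc j + suc m)         ≡⟨ cong (L ∘ suc) (+-suc j m) ⟩
    L (2 + (j + m))           ≤⟨ L-ratio (j + m) ⟩
    6 * L (suc (j + m))       ≡⟨ cong (λ n → 6 * L n) (sym (+-suc j m)) ⟩
    6 * L (j + suc m)         ≤⟨ *-monoʳ-≤ 6 (L-ratio-iterate j m) ⟩
    6 * (6 ^ j * L (suc m))   ≡⟨ sym (*-assoc 6 (6 ^ j) _) ⟩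
    6 ^ suc j * L (suc m)     ∎
    where open ≤-Reasoning

Eventually : (ℕ → Set) → Set
Eventually P = ∃[ N ] (∀ n → N ≤ n → P n)

eventually-+ : ∀ {P : ℕ → Set} a K → (∀ x → K ≤ x → P (a + x)) → Eventually P
eventually-+ {P} a K P[a+_] = a + K , λ n a+K≤n →
  subst P (m+[n∸m]≡n (≤-trans (m≤m+n a K) a+K≤n))
          (P[a+_] (n ∸ a) (subst (_≤ n ∸ a) (m+n∸m≡n a K) (∸-monoˡ-≤ a a+K≤n)))

^-bernoulli : ∀ e t → e ^ t * (e + t) ≤ e * suc e ^ t
^-bernoulli e zero    = ≤-reflexive (trans (*-identityˡ (e + 0)) (trans (+-identityʳ e) (sym (*-identityʳ e))))
^-bernoulli e (suc t) = begin
  e * e ^ t * (e + suc t)          ≤⟨ m≤m+n _ (e ^ t * t) ⟩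
  e * e ^ t * (e + suc t) + e ^ t * t ≡⟨ expand e (e ^ t) t ⟩
  suc e * (e ^ t * (e + t))        ≤⟨ *-monoʳ-≤ (suc e) (^-bernoulli e t) ⟩
  suc e * (e * suc e ^ t)          ≡⟨ *.x∙yz≈y∙xz (suc e) e (suc e ^ t) ⟩
  e * (suc e * suc e ^ t)          ∎
  where
  open ≤-Reasoning
  expand : ∀ e x t → e * x * (e + suc t) + x * t ≡ suc e * (x * (e + t))
  expand = solve-∀

shrink-by-deficit : ∀ e X Y P Q → X + Y ≤ P + Q → suc e * P + Q ≤ suc e * Y → suc e * X ≤ e * Q
shrink-by-deficit e X Y P Q X+Y≤P+Q deficit = +-cancelˡ-≤ (suc e * P + Q) _ _ (begin
  suc e * P + Q + suc e * X   ≤⟨ +-monoˡ-≤ (suc e * X) deficit ⟩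
  suc e * Y + suc e * X       ≡⟨ gather e X Y ⟩
  suc e * (X + Y)             ≤⟨ *-monoʳ-≤ (suc e) X+Y≤P+Q ⟩
  suc e * (P + Q)             ≡⟨ spread e P Q ⟩
  suc e * P + Q + e * Q       ∎)
  where
  open ≤-Reasoning
  gather : ∀ e X Y → suc e * Y + suc e * X ≡ suc e * (X + Y)
  gather = solve-∀
  spread : ∀ e P Q → suc e * (P + Q) ≡ suc e * P + Q + e * Q
  spread = solve-∀

module DensityZero (L G : ℕ → ℕ)
  (L-super : ∀ m → 1 + L m + conv L L m ≤ L (suc m))
  (G-sub : ∀ m → G (suc m) ≤ 1 + G m + conv G G m)
  (G≤L : ∀ n → G n ≤ L n)
  (n₀ : ℕ) (G<L : G n₀ < L n₀)
  (C : ℕ) (L-ratio : ∀ x → 0 < x → L (suc n₀ + x) ≤ C * L x) where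

  E D : ℕ
  E = suc C
  D = suc E

  n≤L : ∀ n → n ≤ L n
  n≤L zero    = z≤n
  n≤L (suc m) = ≤-trans (s≤s (≤-trans (n≤L m) (m≤m+n (L m) (conv L L m)))) (L-super m)

  module Step (t N : ℕ) (H : ∀ n → N ≤ n → D ^ t * G n ≤ E ^ t * L n) where

    product-bound : ∀ a b → N ≤ b → D ^ t * (G a * G b) ≤ E ^ t * (L a * L b)
    product-bound a b N≤b = begin
      D ^ t * (G a * G b) ≡⟨ *.x∙yz≈y∙xz (D ^ t) (G a) (G b) ⟩
      G a * (D ^ t * G b) ≤⟨ *-mono-≤ (G≤L a) (H b N≤b) ⟩
      L a * (E ^ t * L b) ≡⟨ *.x∙yz≈y∙xz (L a) (E ^ t) (L b) ⟩
      E ^ t * (L a * L b) ∎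
      where open ≤-Reasoning

    product-gap : ∀ b → N ≤ b → D ^ t * (G n₀ * G b) + E ^ t * L b ≤ E ^ t * (L n₀ * L b)
    product-gap b N≤b = begin
      D ^ t * (G n₀ * G b) + Y  ≡⟨ cong (_+ Y) (*.x∙yz≈y∙xz (D ^ t) (G n₀) (G b)) ⟩
      G n₀ * (D ^ t * G b) + Y  ≤⟨ +-monoˡ-≤ Y (*-monoʳ-≤ (G n₀) (H b N≤b)) ⟩
      G n₀ * Y + Y              ≡⟨ +-comm (G n₀ * Y) Y ⟩
      suc (G n₀) * Y            ≤⟨ *-monoˡ-≤ Y G<L ⟩
      L n₀ * Y                  ≡⟨ *.x∙yz≈y∙xz (L n₀) (E ^ t) (L b) ⟩
      E ^ t * (L n₀ * L b)      ∎
      where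
      open ≤-Reasoning
      Y = E ^ t * L b

    conv-bound : ∀ x → N + N ≤ x →
                 D ^ t * conv G G (n₀ + x) + E ^ t * L x ≤ E ^ t * conv L L (n₀ + x)
    conv-bound x N+N≤x = begin
      D ^ t * conv G G m + E ^ t * L x
        ≡⟨ cong (_+ E ^ t * L x) (sym (sumTo-*ˡ (D ^ t) (λ i → G i * G (m ∸ i)) m)) ⟩
      sumTo (λ i → D ^ t * (G i * G (m ∸ i))) m + E ^ t * L x
        ≤⟨ sumTo-mono-≤-gap m (m≤m+n n₀ x) termwise gap ⟩
      sumTo (λ i → E ^ t * (L i * L (m ∸ i))) m
        ≡⟨ sumTo-*ˡ (E ^ t) (λ i → L i * L (m ∸ i)) m ⟩
      E ^ t * conv L L m ∎
      where
      open ≤-Reasoning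
      m = n₀ + x
      N+N≤m : N + N ≤ m
      N+N≤m = ≤-trans N+N≤x (m≤n+m x n₀)
      gap : D ^ t * (G n₀ * G (m ∸ n₀)) + E ^ t * L x ≤ E ^ t * (L n₀ * L (m ∸ n₀))
      gap = subst (λ b → D ^ t * (G n₀ * G b) + E ^ t * L x ≤ E ^ t * (L n₀ * L b))
                  (sym (m+n∸m≡n n₀ x)) (product-gap x (≤-trans (m≤m+n N N) N+N≤x))
      -- Of the two factors i and m ∸ i at least one is ≥ N, since m ≥ 2N.
      termwise : ∀ i → i ≤ m → D ^ t * (G i * G (m ∸ i)) ≤ E ^ t * (L i * L (m ∸ i))
      termwise i i≤m with N ≤? m ∸ i
      ... | yes N≤m∸i = product-bound i (m ∸ i) N≤m∸i
      ... | no  N≰m∸i = subst₂ (λ g l → D ^ t * g ≤ E ^ t * l) (*-comm (G (m ∸ i)) (G i)) (*-comm (L (m ∸ i)) (L i))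
                                (product-bound (m ∸ i) i N≤i)
        where
        N≤i : N ≤ i
        N≤i = +-cancelʳ-≤ N N i (begin
          N + N           ≤⟨ N+N≤m ⟩
          m               ≡⟨ sym (m+[n∸m]≡n i≤m) ⟩
          i + (m ∸ i)     ≤⟨ +-monoʳ-≤ i (<⇒≤ (≰⇒> N≰m∸i)) ⟩
          i + N           ∎)

    step : ∀ x → suc (N + N + D ^ suc t) ≤ x → D ^ suc t * G (suc n₀ + x) ≤ E ^ suc t * L (suc n₀ + x)
    step x K<x = begin
      D ^ suc t * G (suc m)    ≡⟨ *-assoc D (D ^ t) (G (suc m)) ⟩
      D * (D ^ t * G (suc m))  ≤⟨ shrink-by-deficit E (D ^ t * G (suc m)) Y (D ^ t) Q deficit growth ⟩
      E * Q                    ≡⟨ sym (*-assoc E (E ^ t) (L (suc m))) ⟩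
      E ^ suc t * L (suc m)    ∎
      where
      open ≤-Reasoning
      m = n₀ + x
      Y = E ^ t * L x
      Q = E ^ t * L (suc m)
      K≤x : N + N + D ^ suc t ≤ x
      K≤x = ≤-trans (n≤1+n _) K<x
      N+N≤x : N + N ≤ x
      N+N≤x = ≤-trans (m≤m+n (N + N) (D ^ suc t)) K≤x
      N≤m : N ≤ m
      N≤m = ≤-trans (m≤m+n N N) (≤-trans N+N≤x (m≤n+m x n₀))
      deficit : D ^ t * G (suc m) + Y ≤ D ^ t + Q
      deficit = begin
        D ^ t * G (suc m) + Y
          ≤⟨ +-monoˡ-≤ Y (*-monoʳ-≤ (D ^ t) (G-sub m)) ⟩
        D ^ t * (1 + G m + conv G G m) + Y
          ≡⟨ expand (D ^ t) (G m) (conv G G m) Y ⟩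
        D ^ t + (D ^ t * G m + (D ^ t * conv G G m + Y))
          ≤⟨ +-monoʳ-≤ (D ^ t) (+-mono-≤ (H m N≤m) (conv-bound x N+N≤x)) ⟩
        D ^ t + (E ^ t * L m + E ^ t * conv L L m)
          ≡⟨ cong (D ^ t +_) (sym (*-distribˡ-+ (E ^ t) (L m) (conv L L m))) ⟩
        D ^ t + E ^ t * (L m + conv L L m)
          ≤⟨ +-monoʳ-≤ (D ^ t) (*-monoʳ-≤ (E ^ t) (≤-trans (n≤1+n _) (L-super m))) ⟩
        D ^ t + Q ∎
        where
        expand : ∀ d g c y → d * (1 + g + c) + y ≡ d + (d * g + (d * c + y))
        expand = solve-∀
      D^[1+t]≤Y : D ^ suc t ≤ Y
      D^[1+t]≤Y = begin
        D ^ suc t             ≤⟨ m≤n+m (D ^ suc t) (N + N) ⟩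
        N + N + D ^ suc t     ≤⟨ K≤x ⟩
        x                     ≤⟨ n≤L x ⟩
        L x                   ≤⟨ m≤n*m (L x) (E ^ t) {{m^n≢0 E t}} ⟩
        Y                     ∎
      growth : D * D ^ t + Q ≤ D * Y
      growth = begin
        D ^ suc t + E ^ t * L (suc m)
          ≤⟨ +-mono-≤ D^[1+t]≤Y (*-monoʳ-≤ (E ^ t) (L-ratio x (≤-trans (s≤s z≤n) K<x))) ⟩
        Y + E ^ t * (C * L x) ≡⟨ cong (Y +_) (*.x∙yz≈y∙xz (E ^ t) C (L x)) ⟩
        E * Y                 ≤⟨ m≤n+m (E * Y) Y ⟩
        D * Y                 ∎

  geometric : ∀ t → Eventually (λ n → D ^ t * G n ≤ E ^ t * L n)
  geometric zero    = 0 , λ n _ → *-monoʳ-≤ 1 (G≤L n)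
  geometric (suc t) with geometric t
  ... | N , H = eventually-+ (suc n₀) (suc (N + N + D ^ suc t)) (Step.step t N H)

  density-zero : ∀ k → Eventually (λ n → G n * suc k ≤ L n)
  density-zero k with geometric (k * E)
  ... | N , H = N , λ n N≤n → *-cancelˡ-≤ (E ^ t) {{m^n≢0 E t}} (begin
      E ^ t * (G n * suc k)   ≡⟨ *.x∙yz≈y∙xz (E ^ t) (G n) (suc k) ⟩
      G n * (E ^ t * suc k)   ≤⟨ *-monoʳ-≤ (G n) (≤-trans (≤-reflexive (*-comm (E ^ t) (suc k))) ratio) ⟩
      G n * D ^ t             ≡⟨ *-comm (G n) (D ^ t) ⟩
      D ^ t * G n             ≤⟨ H n N≤n ⟩
      E ^ t * L n             ∎)
    where
    open ≤-Reasoning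
    t = k * E
    ratio : suc k * E ^ t ≤ D ^ t
    ratio = *-cancelˡ-≤ E (begin
      E * (suc k * E ^ t)     ≡⟨ rearrange E (suc k) (E ^ t) ⟩
      E ^ t * (E + k * E)     ≤⟨ ^-bernoulli E t ⟩
      E * D ^ t               ∎)
      where
      rearrange : ∀ e s x → e * (s * x) ≡ x * (s * e)
      rearrange = solve-∀

ω : Term
ω = lam (app (var 0) (var 0))

Ω : Term
Ω = app ω ω

¬SN-Ω : ¬ SN Ω
¬SN-Ω (acc rs) = ¬SN-Ω (rs β)

SN-reflect : ∀ {f : Term → Term} → (∀ {M M′} → M ⟶ M′ → f M ⟶ f M′) → ∀ {M} → SN (f M) → SN M
SN-reflect f-mono (acc rs) = acc λ M⟶M′ → SN-reflect f-mono (rs (f-mono M⟶M′))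

data ΩFree : Term → Set where
  var : ∀ {k} → ΩFree (var k)
  lam : ∀ {M} → ΩFree M → ΩFree (lam M)
  app : ∀ {M N} → ΩFree M → ΩFree N → app M N ≢ Ω → ΩFree (app M N)

SN⇒ΩFree : ∀ {M} → SN M → ΩFree M
SN⇒ΩFree {var _}   _  = var
SN⇒ΩFree {lam _}   sn = lam (SN⇒ΩFree (SN-reflect ξlam sn))
SN⇒ΩFree {app _ _} sn = app (SN⇒ΩFree (SN-reflect ξl sn)) (SN⇒ΩFree (SN-reflect ξr sn))
                            (λ { refl → ¬SN-Ω sn })

var-injective : ∀ {i j : ℕ} → var i ≡ var j → i ≡ j
var-injective refl = refl

lam-injective : ∀ {M N : Term} → lam M ≡ lam N → M ≡ N
lam-injective refl = refl

app-injective : ∀ {M M′ N N′ : Term} → app M N ≡ app M′ N′ → M ≡ M′ × N ≡ N′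
app-injective refl = refl , refl

_≟_ : DecidableEquality Term
var i   ≟ var j     = map′ (cong var) var-injective (i ≟ℕ j)
lam M   ≟ lam N     = map′ (cong lam) lam-injective (M ≟ N)
app M N ≟ app M′ N′ = map′ (uncurry (cong₂ app)) app-injective ((M ≟ M′) ×-dec (N ≟ N′))
var _   ≟ lam _     = no λ ()
var _   ≟ app _ _   = no λ ()
lam _   ≟ var _     = no λ ()
lam _   ≟ app _ _   = no λ ()
app _ _ ≟ var _     = no λ ()
app _ _ ≟ lam _     = no λ ()

ΩFree? : Decidable ΩFree
ΩFree? (var _)   = yes var
ΩFree? (lam M)   = map′ lam (λ { (lam p) → p }) (ΩFree? M)
ΩFree? (app M N) = map′ (λ (p , q , r) → app p q r) (λ { (app p q r) → p , q , r })
                        (ΩFree? M ×-dec ΩFree? N ×-dec ¬? (app M N ≟ Ω))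

private variable
  A B C : Set

length-filter-map : {P : B → Set} {Q : A → Set} (P? : Decidable P) (Q? : Decidable Q) {f : A → B} →
                    (∀ {x} → P (f x) → Q x) → ∀ xs → length (filter P? (map f xs)) ≤ length (filter Q? xs)
length-filter-map P? Q? P⇒Q []       = z≤n
length-filter-map P? Q? {f} P⇒Q (x ∷ xs) with P? (f x) | Q? x
... | yes _  | yes _ = s≤s (length-filter-map P? Q? P⇒Q xs)
... | yes px | no ¬q = contradiction (P⇒Q px) ¬q
... | no _   | yes _ = m≤n⇒m≤1+n (length-filter-map P? Q? P⇒Q xs)
... | no _   | no _  = length-filter-map P? Q? P⇒Q xs

length-cartesianProductWith : ∀ (f : A → B → C) xs ys →
  length (cartesianProductWith f xs ys) ≡ length xs * length ys
length-cartesianProductWith f []       ys = refl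
length-cartesianProductWith f (x ∷ xs) ys = trans (length-++ (map (f x) ys))
  (cong₂ _+_ (length-map (f x) ys) (length-cartesianProductWith f xs ys))

length-filter-++ : {P : A → Set} (P? : Decidable P) → ∀ xs ys →
                   length (filter P? (xs ++ ys)) ≡ length (filter P? xs) + length (filter P? ys)
length-filter-++ P? xs ys = trans (cong length (filter-++ P? xs ys)) (length-++ (filter P? xs))

length-filter-cartesianProductWith :
  {P : C → Set} {Q : A → Set} {R : B → Set} (P? : Decidable P) (Q? : Decidable Q) (R? : Decidable R)
  (f : A → B → C) → (∀ {x y} → P (f x y) → Q x × R y) → ∀ xs ys →
  length (filter P? (cartesianProductWith f xs ys)) ≤ length (filter Q? xs) * length (filter R? ys)
length-filter-cartesianProductWith P? Q? R? f split [] ys = z≤n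
length-filter-cartesianProductWith P? Q? R? f split (x ∷ xs) ys = begin
  length (filter P? (map (f x) ys ++ cartesianProductWith f xs ys))
    ≡⟨ length-filter-++ P? (map (f x) ys) (cartesianProductWith f xs ys) ⟩
  length (filter P? (map (f x) ys)) + length (filter P? (cartesianProductWith f xs ys))
    ≤⟨ +-monoʳ-≤ _ (length-filter-cartesianProductWith P? Q? R? f split xs ys) ⟩
  length (filter P? (map (f x) ys)) + length (filter Q? xs) * length (filter R? ys)
    ≤⟨ row ⟩
  length (filter Q? (x ∷ xs)) * length (filter R? ys) ∎
  where
  open ≤-Reasoning
  row : length (filter P? (map (f x) ys)) + length (filter Q? xs) * length (filter R? ys) ≤
        length (filter Q? (x ∷ xs)) * length (filter R? ys)
  row with Q? x
  ... | yes _  = +-monoˡ-≤ _ (length-filter-map P? R? (proj₂ ∘ split) ys)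
  ... | no ¬qx = ≤-reflexive (cong (λ zs → length zs + _)
                   (filter-none P? (All.map⁺ (All.universal (λ y → ¬qx ∘ proj₁ ∘ split) ys))))

unique-⊆⇒length≤ : ∀ {xs ys : List A} → Unique xs → xs ⊆ ys → length xs ≤ length ys
unique-⊆⇒length≤ {xs = []}     _                _    = z≤n
unique-⊆⇒length≤ {xs = x ∷ xs} (x∉xs ∷ xs-unique) x∷xs⊆ys with ∈-∃++ (x∷xs⊆ys (here refl))
... | ys₁ , ys₂ , refl = begin
  suc (length xs)              ≤⟨ s≤s (unique-⊆⇒length≤ xs-unique xs⊆ys₁++ys₂) ⟩
  suc (length (ys₁ ++ ys₂))    ≡⟨ cong suc (length-++ ys₁) ⟩
  suc (length ys₁ + length ys₂) ≡⟨ sym (+-suc (length ys₁) (length ys₂)) ⟩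
  length ys₁ + length (x ∷ ys₂) ≡⟨ sym (length-++ ys₁) ⟩
  length (ys₁ ++ x ∷ ys₂)      ∎
  where
  open ≤-Reasoning
  xs⊆ys₁++ys₂ : xs ⊆ ys₁ ++ ys₂
  xs⊆ys₁++ys₂ {y} y∈xs with ∈-++⁻ ys₁ (x∷xs⊆ys (there y∈xs))
  ... | inj₁ y∈ys₁         = ∈-++⁺ˡ y∈ys₁
  ... | inj₂ (here refl)   = contradiction refl (All.lookup x∉xs y∈xs)
  ... | inj₂ (there y∈ys₂) = ∈-++⁺ʳ ys₁ y∈ys₂

convWith : (A → B → C) → (ℕ → List A) → (ℕ → List B) → ℕ → List C
convWith f as bs zero    = cartesianProductWith f (as 0) (bs 0)
convWith f as bs (suc m) = cartesianProductWith f (as 0) (bs (suc m)) ++ convWith f (as ∘ suc) bs m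

module _ (f : A → B → C) where

  ∈-convWith⁺ : ∀ as bs {m i a b} → i ≤ m → a ∈ as i → b ∈ bs (m ∸ i) → f a b ∈ convWith f as bs m
  ∈-convWith⁺ as bs {zero}  z≤n       a∈ b∈ = ∈-cartesianProductWith⁺ f a∈ b∈
  ∈-convWith⁺ as bs {suc m} z≤n       a∈ b∈ = ∈-++⁺ˡ (∈-cartesianProductWith⁺ f a∈ b∈)
  ∈-convWith⁺ as bs {suc m} (s≤s i≤m) a∈ b∈ = ∈-++⁺ʳ _ (∈-convWith⁺ (as ∘ suc) bs i≤m a∈ b∈)

  ∈-convWith⁻ : ∀ as bs m {v} → v ∈ convWith f as bs m →
                ∃[ i ] ∃₂ λ a b → i ≤ m × a ∈ as i × b ∈ bs (m ∸ i) × v ≡ f a b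
  ∈-convWith⁻ as bs zero v∈ with ∈-cartesianProductWith⁻ f (as 0) (bs 0) v∈
  ... | a , b , a∈ , b∈ , v≡ = 0 , a , b , z≤n , a∈ , b∈ , v≡
  ∈-convWith⁻ as bs (suc m) v∈ with ∈-++⁻ (cartesianProductWith f (as 0) (bs (suc m))) v∈
  ... | inj₁ v∈₀ with ∈-cartesianProductWith⁻ f (as 0) (bs (suc m)) v∈₀
  ...   | a , b , a∈ , b∈ , v≡ = 0 , a , b , z≤n , a∈ , b∈ , v≡
  ∈-convWith⁻ as bs (suc m) v∈ | inj₂ v∈₊ with ∈-convWith⁻ (as ∘ suc) bs m v∈₊
  ...   | i , a , b , i≤m , a∈ , b∈ , v≡ = suc i , a , b , s≤s i≤m , a∈ , b∈ , v≡

  convWith-cong : ∀ {as as′ bs bs′} m → (∀ i → i ≤ m → as i ≡ as′ i) → (∀ i → i ≤ m → bs i ≡ bs′ i) →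
                  convWith f as bs m ≡ convWith f as′ bs′ m
  convWith-cong zero    as≡ bs≡ = cong₂ (cartesianProductWith f) (as≡ 0 z≤n) (bs≡ 0 z≤n)
  convWith-cong (suc m) as≡ bs≡ =
    cong₂ _++_ (cong₂ (cartesianProductWith f) (as≡ 0 z≤n) (bs≡ (suc m) ≤-refl))
               (convWith-cong m (λ i i≤m → as≡ (suc i) (s≤s i≤m)) (λ i i≤m → bs≡ i (m≤n⇒m≤1+n i≤m)))

  length-convWith : ∀ as bs m → length (convWith f as bs m) ≡ conv (length ∘ as) (length ∘ bs) m
  length-convWith as bs zero    = length-cartesianProductWith f (as 0) (bs 0)
  length-convWith as bs (suc m) = begin
    length (cartesianProductWith f (as 0) (bs (suc m)) ++ convWith f (as ∘ suc) bs m)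
      ≡⟨ length-++ (cartesianProductWith f (as 0) (bs (suc m))) ⟩
    length (cartesianProductWith f (as 0) (bs (suc m))) + length (convWith f (as ∘ suc) bs m)
      ≡⟨ cong₂ _+_ (length-cartesianProductWith f (as 0) (bs (suc m))) (length-convWith (as ∘ suc) bs m) ⟩
    length (as 0) * length (bs (suc m)) + conv (length ∘ as ∘ suc) (length ∘ bs) m
      ≡⟨ sym (conv-suc (length ∘ as) (length ∘ bs) m) ⟩
    conv (length ∘ as) (length ∘ bs) (suc m) ∎
    where open ≡-Reasoning

  length-filter-convWith : {P : C → Set} {Q : A → Set} {R : B → Set}
    (P? : Decidable P) (Q? : Decidable Q) (R? : Decidable R) → (∀ {x y} → P (f x y) → Q x × R y) →
    ∀ as bs m → length (filter P? (convWith f as bs m)) ≤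
                conv (λ i → length (filter Q? (as i))) (λ j → length (filter R? (bs j))) m
  length-filter-convWith P? Q? R? split as bs zero =
    length-filter-cartesianProductWith P? Q? R? f split (as 0) (bs 0)
  length-filter-convWith P? Q? R? split as bs (suc m) = begin
    length (filter P? (cartesianProductWith f (as 0) (bs (suc m)) ++ convWith f (as ∘ suc) bs m))
      ≡⟨ length-filter-++ P? (cartesianProductWith f (as 0) (bs (suc m))) _ ⟩
    length (filter P? (cartesianProductWith f (as 0) (bs (suc m)))) + length (filter P? (convWith f (as ∘ suc) bs m))
      ≤⟨ +-mono-≤ (length-filter-cartesianProductWith P? Q? R? f split (as 0) (bs (suc m)))
                  (length-filter-convWith P? Q? R? split (as ∘ suc) bs m) ⟩
    #Q 0 * #R (suc m) + conv (#Q ∘ suc) #R m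
      ≡⟨ sym (conv-suc #Q #R m) ⟩
    conv #Q #R (suc m) ∎
    where
    open ≤-Reasoning
    #Q = λ i → length (filter Q? (as i))
    #R = λ j → length (filter R? (bs j))

  convWith-unique : (∀ {w x y z} → f w y ≡ f x z → w ≡ x × y ≡ z) → ∀ {as bs} →
                    (∀ i → Unique (as i)) → (∀ i → Unique (bs i)) →
                    (∀ {i j a} → a ∈ as i → a ∈ as j → i ≡ j) → ∀ m → Unique (convWith f as bs m)
  convWith-unique f-inj as-unique bs-unique as-disjoint zero =
    Unique.cartesianProductWith⁺ f f-inj (as-unique 0) (bs-unique 0)
  convWith-unique f-inj {as} {bs} as-unique bs-unique as-disjoint (suc m) =
    Unique.++⁺ (Unique.cartesianProductWith⁺ f f-inj (as-unique 0) (bs-unique (suc m)))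
               (convWith-unique f-inj (as-unique ∘ suc) bs-unique (λ a∈ a∈′ → suc-injective (as-disjoint a∈ a∈′)) m)
               disjoint
    where
    disjoint : ∀ {v} → ¬ (v ∈ cartesianProductWith f (as 0) (bs (suc m)) × v ∈ convWith f (as ∘ suc) bs m)
    disjoint (v∈₀ , v∈₊) with ∈-cartesianProductWith⁻ f (as 0) (bs (suc m)) v∈₀ | ∈-convWith⁻ (as ∘ suc) bs m v∈₊
    ... | a , _ , a∈ , _ , refl | i , _ , _ , _ , a′∈ , _ , fab≡ with f-inj fab≡
    ...   | refl , refl with as-disjoint a∈ a′∈
    ...     | ()

-- terms k n lists the terms of size n, provided n ≤ k; the fuel k makes the
-- recursion structural.
terms : ℕ → ℕ → List Term
terms zero    _       = []
terms (suc k) zero    = []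
terms (suc k) (suc m) = var m ∷ (map lam (terms k m) ++ convWith app (terms k) (terms k) m)

termsOfSize : ℕ → List Term
termsOfSize n = terms n n

terms-sound : ∀ k n {M} → M ∈ terms k n → size M ≡ n
terms-sound (suc k) (suc m) (here refl) = refl
terms-sound (suc k) (suc m) (there M∈) with ∈-++⁻ (map lam (terms k m)) M∈
... | inj₁ M∈lam with ∈-map⁻ lam M∈lam
...   | N , N∈ , refl = cong suc (terms-sound k m N∈)
terms-sound (suc k) (suc m) (there M∈) | inj₂ M∈app with ∈-convWith⁻ app (terms k) (terms k) m M∈app
...   | i , P , Q , i≤m , P∈ , Q∈ , refl =
  cong suc (trans (cong₂ _+_ (terms-sound k i P∈) (terms-sound k (m ∸ i) Q∈)) (m+[n∸m]≡n i≤m))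

terms-complete : ∀ k M → size M ≤ k → M ∈ terms k (size M)
terms-complete (suc k) (var _)   _         = here refl
terms-complete (suc k) (lam M)   (s≤s M≤k) = there (∈-++⁺ˡ (∈-map⁺ lam (terms-complete k M M≤k)))
terms-complete (suc k) (app P Q) (s≤s PQ≤k) = there (∈-++⁺ʳ (map lam (terms k (size P + size Q)))
  (∈-convWith⁺ app (terms k) (terms k) (m≤m+n (size P) (size Q))
    (terms-complete k P (≤-trans (m≤m+n (size P) (size Q)) PQ≤k))
    (subst (λ n → Q ∈ terms k n) (sym (m+n∸m≡n (size P) (size Q)))
      (terms-complete k Q (≤-trans (m≤n+m (size Q) (size P)) PQ≤k)))))

terms-unique : ∀ k n → Unique (terms k n)
terms-unique zero    _       = []
terms-unique (suc k) zero    = []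
terms-unique (suc k) (suc m) =
  All.tabulate var∉ ∷ Unique.++⁺ (Unique.map⁺ lam-injective (terms-unique k m))
                                 (convWith-unique app app-injective (terms-unique k) (terms-unique k) size-agrees m)
                                 lam∉app
  where
  size-agrees : ∀ {i j M} → M ∈ terms k i → M ∈ terms k j → i ≡ j
  size-agrees {i} {j} M∈i M∈j = trans (sym (terms-sound k i M∈i)) (terms-sound k j M∈j)
  var∉ : ∀ {M} → M ∈ map lam (terms k m) ++ convWith app (terms k) (terms k) m → var m ≢ M
  var∉ M∈ refl with ∈-++⁻ (map lam (terms k m)) M∈
  ... | inj₁ M∈lam with ∈-map⁻ lam M∈lam
  ...   | _ , _ , ()
  var∉ M∈ refl | inj₂ M∈app with ∈-convWith⁻ app (terms k) (terms k) m M∈app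
  ...   | _ , _ , _ , _ , _ , _ , ()
  lam∉app : ∀ {M} → ¬ (M ∈ map lam (terms k m) × M ∈ convWith app (terms k) (terms k) m)
  lam∉app (M∈lam , M∈app) with ∈-map⁻ lam M∈lam | ∈-convWith⁻ app (terms k) (terms k) m M∈app
  ... | _ , _ , refl | _ , _ , _ , _ , _ , _ , ()

terms-fuel : ∀ k l n → n ≤ k → n ≤ l → terms k n ≡ terms l n
terms-fuel zero    zero    zero    _         _         = refl
terms-fuel zero    (suc l) zero    _         _         = refl
terms-fuel (suc k) zero    zero    _         _         = refl
terms-fuel (suc k) (suc l) zero    _         _         = refl
terms-fuel (suc k) (suc l) (suc m) (s≤s m≤k) (s≤s m≤l) =
  cong₂ (λ lams apps → var m ∷ (map lam lams ++ apps)) (terms-fuel k l m m≤k m≤l)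
        (convWith-cong app m fuel fuel)
  where
  fuel : ∀ i → i ≤ m → terms k i ≡ terms l i
  fuel i i≤m = terms-fuel k l i (≤-trans i≤m m≤k) (≤-trans i≤m m≤l)

termsOfSize-suc : ∀ m → termsOfSize (suc m) ≡
                  var m ∷ (map lam (termsOfSize m) ++ convWith app termsOfSize termsOfSize m)
termsOfSize-suc m = cong (λ apps → var m ∷ (map lam (termsOfSize m) ++ apps))
                         (convWith-cong app m fuel fuel)
  where
  fuel : ∀ i → i ≤ m → terms m i ≡ termsOfSize i
  fuel i i≤m = terms-fuel m i i i≤m ≤-refl

∈-termsOfSize : ∀ {M n} → size M ≡ n → M ∈ termsOfSize n
∈-termsOfSize {M} refl = terms-complete (size M) M ≤-refl

#terms : ℕ → ℕ
#terms n = length (termsOfSize n)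

#ΩFree : ℕ → ℕ
#ΩFree n = length (filter ΩFree? (termsOfSize n))

#terms-suc : ∀ m → #terms (suc m) ≡ 1 + #terms m + conv #terms #terms m
#terms-suc m = begin
  length (termsOfSize (suc m))
    ≡⟨ cong length (termsOfSize-suc m) ⟩
  suc (length (map lam (termsOfSize m) ++ convWith app termsOfSize termsOfSize m))
    ≡⟨ cong suc (length-++ (map lam (termsOfSize m))) ⟩
  suc (length (map lam (termsOfSize m)) + length (convWith app termsOfSize termsOfSize m))
    ≡⟨ cong suc (cong₂ _+_ (length-map lam (termsOfSize m)) (length-convWith app termsOfSize termsOfSize m)) ⟩
  1 + #terms m + conv #terms #terms m ∎
  where open ≡-Reasoning

#ΩFree-suc : ∀ m → #ΩFree (suc m) ≤ 1 + #ΩFree m + conv #ΩFree #ΩFree m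
#ΩFree-suc m = begin
  length (filter ΩFree? (termsOfSize (suc m)))
    ≡⟨ cong (length ∘ filter ΩFree?) (termsOfSize-suc m) ⟩
  suc (length (filter ΩFree? (map lam (termsOfSize m) ++ convWith app termsOfSize termsOfSize m)))
    ≡⟨ cong suc (length-filter-++ ΩFree? (map lam (termsOfSize m)) _) ⟩
  suc (length (filter ΩFree? (map lam (termsOfSize m))) +
       length (filter ΩFree? (convWith app termsOfSize termsOfSize m)))
    ≤⟨ s≤s (+-mono-≤ (length-filter-map ΩFree? ΩFree? (λ { (lam p) → p }) (termsOfSize m))
                     (length-filter-convWith app ΩFree? ΩFree? ΩFree? (λ { (app p q _) → p , q })
                                             termsOfSize termsOfSize m)) ⟩
  1 + #ΩFree m + conv #ΩFree #ΩFree m ∎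
  where open ≤-Reasoning

#ΩFree≤#terms : ∀ n → #ΩFree n ≤ #terms n
#ΩFree≤#terms n = length-filter ΩFree? (termsOfSize n)

#ΩFree<#terms : #ΩFree (size Ω) < #terms (size Ω)
#ΩFree<#terms = filter-notAll ΩFree? (termsOfSize (size Ω))
                  (lose (∈-termsOfSize {Ω} refl) λ { (app _ _ Ω≢Ω) → Ω≢Ω refl })

#terms-ratio : ∀ x → 0 < x → #terms (suc (size Ω) + x) ≤ 6 ^ suc (size Ω) * #terms x
#terms-ratio (suc y) _ = RatioBound.L-ratio-iterate #terms refl #terms-suc (suc (size Ω)) y

ΩFree-density-zero : ∀ k → Eventually (λ n → #ΩFree n * suc k ≤ #terms n)
ΩFree-density-zero = DensityZero.density-zero #terms #ΩFree (λ m → ≤-reflexive (sym (#terms-suc m))) #ΩFree-suc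
                       #ΩFree≤#terms (size Ω) #ΩFree<#terms (6 ^ suc (size Ω)) #terms-ratio

SN-terms⊆ΩFree-terms : ∀ {n xs} → All SN xs → All (λ M → size M ≡ n) xs → xs ⊆ filter ΩFree? (termsOfSize n)
SN-terms⊆ΩFree-terms xs-SN xs-size M∈ =
  ∈-filter⁺ ΩFree? (∈-termsOfSize (All.lookup xs-size M∈)) (SN⇒ΩFree (All.lookup xs-SN M∈))

termsOfSize-⊆ : ∀ {n} {ys : List Term} → ((M : Term) → size M ≡ n → M ∈ ys) → termsOfSize n ⊆ ys
termsOfSize-⊆ {n} ys-complete M∈ = ys-complete _ (terms-sound n n M∈)

corollary2 : (k : ℕ) → ∃[ N ] ((n : ℕ) → N ≤ n →
               (xs ys : List Term) →
               Unique xs → All SN xs → All (λ M → size M ≡ n) xs →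
               Unique ys → All (λ M → size M ≡ n) ys →
               ((M : Term) → size M ≡ n → M ∈ ys) →
               length xs * suc k ≤ length ys)
corollary2 k = let N , dense = ΩFree-density-zero k in
  N , λ n N≤n xs ys xs-unique xs-SN xs-size _ _ ys-complete → begin
  length xs * suc k      ≤⟨ *-monoˡ-≤ (suc k) (unique-⊆⇒length≤ xs-unique (SN-terms⊆ΩFree-terms xs-SN xs-size)) ⟩
  #ΩFree n * suc k       ≤⟨ dense n N≤n ⟩
  #terms n               ≤⟨ unique-⊆⇒length≤ (terms-unique n n) (termsOfSize-⊆ ys-complete) ⟩
  length ys              ∎
  where open ≤-Reasoning
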